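{- There is no nonempty graph $G$ such that every vertex of $G$ has degree $n$ and, for every vertex $v$, the neighborhood of $v$ contains exactly $\frac{n(n-1)}{2}-p_v$ edges, where $1\leqslant p_v<\frac{n}{2}$ (the number $p_v$ may depend on $v$).
   Context: Graphs are undirected, without loops and multiple edges. The neighborhood of a vertex $v$ in $G$ is the induced subgraph of $G$ on the set of all vertices adjacent to $v$. -}

module Defs where

open import Data.Bool using (Bool; true; false; if_then_else_; _∧_)
open import Data.Nat using (ℕ; zero; suc; _<ᵇ_)
open import Data.Fin using (Fin; toℕ)
open import Data.List using (List; map; allFin)
open import Data.Nat.ListAction using (sum)
open import Relation.Binary.PropositionalEquality using (_≡_)

record Graph (m : ℕ) : Set where
  field
    adj   : Fin m → Fin m → Bool
    sym   : ∀ x y → adj x y ≡ adj y x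
    loopless : ∀ x → adj x x ≡ false

open Graph public

count : Bool → ℕ
count b = if b then 1 else 0

degree : ∀ {m} → Graph m → Fin m → ℕ
degree {m} G v = sum (map (λ y → count (adj G v y)) (allFin m))

-- number of edges of the neighbourhood of v (induced subgraph on the
-- vertices adjacent to v): unordered pairs {x , y}, counted once via x < y,
-- with x and y both adjacent to v and adjacent to each other.
nbhdEdges : ∀ {m} → Graph m → Fin m → ℕ
nbhdEdges {m} G v =
  sum (map (λ x → sum (map (λ y →
        count ((toℕ x <ᵇ toℕ y) ∧ (adj G v x ∧ (adj G v y ∧ adj G x y))))
      (allFin m))) (allFin m))

-- Write u(x,y) = |N(x) ∖ N[y]| (unshared) and S(y) = Σ_{z ∼ y} u(y,z) (totalUnshared).
-- For z ∼ y regularity gives n = |N(y) ∩ N(z)| + u(y,z) + 1; summing over z ∈ N(y)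
-- counts every edge inside N(y) twice, so S(y) = n(n-1) - 2·e(N(y)) = 2p_y, whence 0 < S(y) < n.
-- Call z a twin of x when N[x] = N[z], and let t_x be the size of the twin class of x.
-- As S > 0 there are adjacent non-twins x, v.  Split N[x] into the twins of v, the
-- twins of x, N(x) ∖ N[v] (of size u = u(x,v) ≥ 1) and r further vertices, so
-- n + 1 = t_v + t_x + u + r.  The summands of S(x) are at least u on the twins of v,
-- at least t_v on N(x) ∖ N[v] and at least 1 on the rest, so 2·t_v·u + r ≤ S(x) < n.
-- With t_v·u ≥ t_v + u - 1 this yields t_v < t_x; by symmetry t_x < t_v.

module Submission where

open import Data.Bool using (Bool; true; false; T; _∧_; not; if_then_else_)
open import Data.Bool.Properties using (∧-assoc; ∧-comm; ∧-zeroʳ)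
open import Data.Empty using (⊥-elim)
open import Data.Fin using (Fin; zero; suc; toℕ)
import Data.Fin.Properties as Fin
open import Data.List using (map; allFin; tabulate)
open import Data.List.Properties using (map-tabulate)
open import Data.Nat
open import Data.Nat.DivMod using (m*n/n≡m)
import Data.Nat.ListAction as List
open import Data.Nat.Properties
open import Data.Nat.Tactic.RingSolver using (solve-∀)
open import Data.Product using (∃; _×_; _,_; proj₁; proj₂)
open import Data.Sum using (inj₁; inj₂)
open import Function using (id; _∘_)
open import Level using (0ℓ)
open import Algebra.Properties.CommutativeMonoid.Sum +-0-commutativeMonoid
  using (sum-cong-≗; ∑-distrib-+; ∑-comm; sum-replicate-zero) renaming (sum to ∑)
open import Relation.Nullary using (¬_; yes; no; does; ¬?; _×-dec_)
open import Relation.Nullary.Decidable using (T?)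
open import Relation.Unary using (Pred; Decidable; _∈_; _∉_; _∩_; _∖_; _∪_; ｛_｝; _⊆_; _≐_; Empty)
open import Relation.Unary.Properties using (_∩?_; _∪?_)
open import Relation.Binary.PropositionalEquality

open import Defs hiding (sym)

-- Finite sums over Fin m

sum-map-allFin : ∀ {m} (f : Fin m → ℕ) → List.sum (map f (allFin m)) ≡ ∑ f
sum-map-allFin f = trans (cong List.sum (map-tabulate id f)) (sum-tabulate f)
  where
  sum-tabulate : ∀ {k} (g : Fin k → ℕ) → List.sum (tabulate g) ≡ ∑ g
  sum-tabulate {zero}  g = refl
  sum-tabulate {suc k} g = cong (g zero +_) (sum-tabulate (g ∘ suc))

∑-mono-≤ : ∀ {m} {f g : Fin m → ℕ} → (∀ i → f i ≤ g i) → ∑ f ≤ ∑ g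
∑-mono-≤ {zero}  f≤g = z≤n
∑-mono-≤ {suc m} f≤g = +-mono-≤ (f≤g zero) (∑-mono-≤ (f≤g ∘ suc))

≤-∑ : ∀ {m} (f : Fin m → ℕ) i → f i ≤ ∑ f
≤-∑ f zero    = m≤m+n (f zero) _
≤-∑ f (suc i) = ≤-trans (≤-∑ (f ∘ suc) i) (m≤n+m _ (f zero))

∑-single : ∀ {m} (f : Fin m → ℕ) i → (∀ j → j ≢ i → f j ≡ 0) → ∑ f ≡ f i
∑-single {suc m} f zero    f≡0 = begin
  f zero + ∑ (f ∘ suc)   ≡⟨ cong (f zero +_) (trans (sum-cong-≗ (λ j → f≡0 (suc j) λ ())) (sum-replicate-zero m)) ⟩
  f zero + 0             ≡⟨ +-identityʳ (f zero) ⟩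
  f zero                 ∎
  where open ≡-Reasoning
∑-single {suc m} f (suc i) f≡0 =
  trans (cong (_+ ∑ (f ∘ suc)) (f≡0 zero λ ()))
        (∑-single (f ∘ suc) i (λ j j≢i → f≡0 (suc j) (j≢i ∘ Fin.suc-injective)))

∑-pos⇒∃ : ∀ {m} (f : Fin m → ℕ) → 0 < ∑ f → ∃ λ i → 0 < f i
∑-pos⇒∃ {suc m} f ∑>0 with f zero in eq
... | suc _ = zero , subst (0 <_) (sym eq) z<s
... | zero  = let i , fi>0 = ∑-pos⇒∃ (f ∘ suc) ∑>0 in suc i , fi>0

∑-mono-≤-≡⇒≗ : ∀ {m} (f g : Fin m → ℕ) → (∀ i → f i ≤ g i) → ∑ f ≡ ∑ g → ∀ i → f i ≡ g i
∑-mono-≤-≡⇒≗ {suc m} f g f≤g ∑≡ = λ where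
    zero    → head≡
    (suc i) → ∑-mono-≤-≡⇒≗ (f ∘ suc) (g ∘ suc) (f≤g ∘ suc) tail≡ i
  where
  head≡ : f zero ≡ g zero
  head≡ = ≤-antisym (f≤g zero) (+-cancelʳ-≤ _ _ _ (begin
    g zero + ∑ (g ∘ suc)   ≡⟨ ∑≡ ⟨
    f zero + ∑ (f ∘ suc)   ≤⟨ +-monoʳ-≤ (f zero) (∑-mono-≤ (f≤g ∘ suc)) ⟩
    f zero + ∑ (g ∘ suc)   ∎))
    where open ≤-Reasoning
  tail≡ : ∑ (f ∘ suc) ≡ ∑ (g ∘ suc)
  tail≡ = +-cancelˡ-≡ (f zero) _ _ (trans ∑≡ (cong (_+ ∑ (g ∘ suc)) (sym head≡)))

∑∑-count-symmetric : ∀ {m} (R : Fin m → Fin m → Bool) →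
  (∀ i j → R i j ≡ R j i) → (∀ i → R i i ≡ false) →
  ∑ (λ i → ∑ (λ j → count (R i j))) ≡ 2 * ∑ (λ i → ∑ (λ j → count ((toℕ i <ᵇ toℕ j) ∧ R i j)))
∑∑-count-symmetric {m} R R-sym R-irrefl = begin
  ∑ (λ i → ∑ (λ j → count (R i j)))
    ≡⟨ sum-cong-≗ (λ i → trans (sum-cong-≗ (split i)) (∑-distrib-+ {m} _ _)) ⟩
  ∑ (λ i → ∑ (below i) + ∑ (λ j → below j i))  ≡⟨ ∑-distrib-+ {m} _ _ ⟩
  ∑∑below + ∑ (λ i → ∑ (λ j → below j i))     ≡⟨ cong (∑∑below +_) (∑-comm {m} {m} below) ⟨
  ∑∑below + ∑∑below                            ≡⟨ cong (∑∑below +_) (+-identityʳ ∑∑below) ⟨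
  2 * ∑∑below                                  ∎
  where
  open ≡-Reasoning
  below : Fin m → Fin m → ℕ
  below i j = count ((toℕ i <ᵇ toℕ j) ∧ R i j)
  ∑∑below : ℕ
  ∑∑below = ∑ (λ i → ∑ (below i))
  <ᵇ-true : ∀ a b → (a <ᵇ b) ≡ true → a < b
  <ᵇ-true a b eq = <ᵇ⇒< a b (subst T (sym eq) _)
  <ᵇ-false : ∀ a b → (a <ᵇ b) ≡ false → a ≮ b
  <ᵇ-false a b eq = subst T eq ∘ <⇒<ᵇ
  split : ∀ i j → count (R i j) ≡ below i j + below j i
  split i j with toℕ i <ᵇ toℕ j in i<j | toℕ j <ᵇ toℕ i in j<i
  ... | true  | true  = ⊥-elim (<-asym (<ᵇ-true (toℕ i) (toℕ j) i<j) (<ᵇ-true (toℕ j) (toℕ i) j<i))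
  ... | true  | false = sym (+-identityʳ _)
  ... | false | true  = cong count (R-sym i j)
  ... | false | false = cong count (trans (cong (R i) (sym i≡j)) (R-irrefl i))
    where
    i≡j : i ≡ j
    i≡j = Fin.toℕ-injective (≤-antisym (≮⇒≥ (<ᵇ-false (toℕ j) (toℕ i) j<i)) (≮⇒≥ (<ᵇ-false (toℕ i) (toℕ j) i<j)))

-- Counting decidable subsets of Fin m

module _ {m : ℕ} where

  _∖?_ : {P Q : Pred (Fin m) 0ℓ} → Decidable P → Decidable Q → Decidable (P ∖ Q)
  (P? ∖? Q?) i = P? i ×-dec ¬? (Q? i)

  ∑⟨_⟩ : {P : Pred (Fin m) 0ℓ} → Decidable P → (Fin m → ℕ) → ℕ
  ∑⟨ P? ⟩ f = ∑ (λ i → if does (P? i) then f i else 0)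

  # : {P : Pred (Fin m) 0ℓ} → Decidable P → ℕ
  # P? = ∑⟨ P? ⟩ (λ _ → 1)

  module _ {P : Pred (Fin m) 0ℓ} (P? : Decidable P) where

    ∑⟨⟩-cong : {f g : Fin m → ℕ} → (∀ {i} → i ∈ P → f i ≡ g i) → ∑⟨ P? ⟩ f ≡ ∑⟨ P? ⟩ g
    ∑⟨⟩-cong f≗g = sum-cong-≗ pointwise
      where
      pointwise : ∀ i → (if does (P? i) then _ else 0) ≡ (if does (P? i) then _ else 0)
      pointwise i with P? i
      ... | yes i∈P = f≗g i∈P
      ... | no  _   = refl

    ∑⟨⟩-distrib-+ : ∀ (f g : Fin m → ℕ) → ∑⟨ P? ⟩ (λ i → f i + g i) ≡ ∑⟨ P? ⟩ f + ∑⟨ P? ⟩ g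
    ∑⟨⟩-distrib-+ f g = trans (sum-cong-≗ pointwise) (∑-distrib-+ {m} _ _)
      where
      pointwise : ∀ i → (if does (P? i) then f i + g i else 0)
                      ≡ (if does (P? i) then f i else 0) + (if does (P? i) then g i else 0)
      pointwise i with does (P? i)
      ... | true  = refl
      ... | false = refl

    ∑⟨⟩-const : ∀ c → ∑⟨ P? ⟩ (λ _ → c) ≡ # P? * c
    ∑⟨⟩-const c = go {m} (does ∘ P?)
      where
      go : ∀ {k} (b : Fin k → Bool) → ∑ (λ i → if b i then c else 0) ≡ ∑ (λ i → if b i then 1 else 0) * c
      go {zero}  b = refl
      go {suc k} b with b zero
      ... | true  = cong (c +_) (go (b ∘ suc))
      ... | false = go (b ∘ suc)

    #*≤∑⟨⟩ : ∀ (f : Fin m → ℕ) c → (∀ {i} → i ∈ P → c ≤ f i) → # P? * c ≤ ∑⟨ P? ⟩ f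
    #*≤∑⟨⟩ f c c≤f = begin
      # P? * c            ≡⟨ ∑⟨⟩-const c ⟨
      ∑⟨ P? ⟩ (λ _ → c)   ≤⟨ ∑-mono-≤ pointwise ⟩
      ∑⟨ P? ⟩ f           ∎
      where
      open ≤-Reasoning
      pointwise : ∀ i → (if does (P? i) then c else 0) ≤ (if does (P? i) then f i else 0)
      pointwise i with P? i
      ... | yes i∈P = c≤f i∈P
      ... | no  _   = z≤n

    ∑⟨⟩-pos⇒∃ : ∀ (f : Fin m → ℕ) → 0 < ∑⟨ P? ⟩ f → ∃ λ i → i ∈ P × 0 < f i
    ∑⟨⟩-pos⇒∃ f ∑>0 = let i , i-pos = ∑-pos⇒∃ _ ∑>0 in i , member i i-pos
      where
      member : ∀ i → 0 < (if does (P? i) then f i else 0) → i ∈ P × 0 < f i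
      member i with P? i
      ... | yes i∈P = i∈P ,_
      ... | no  _   = λ ()

    #-empty : Empty P → # P? ≡ 0
    #-empty ∉P = trans (sum-cong-≗ pointwise) (sum-replicate-zero m)
      where
      pointwise : ∀ i → (if does (P? i) then 1 else 0) ≡ 0
      pointwise i with P? i
      ... | yes i∈P = ⊥-elim (∉P i i∈P)
      ... | no  _   = refl

    #-singleton : ∀ {i} → i ∈ P → (∀ {j} → j ∈ P → j ≡ i) → # P? ≡ 1
    #-singleton {i} i∈P unique = trans (∑-single _ i outside) inside
      where
      outside : ∀ j → j ≢ i → (if does (P? j) then 1 else 0) ≡ 0
      outside j j≢i with P? j
      ... | yes j∈P = ⊥-elim (j≢i (unique j∈P))
      ... | no  _   = refl
      inside : (if does (P? i) then 1 else 0) ≡ 1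
      inside with P? i
      ... | yes _   = refl
      ... | no  i∉P = ⊥-elim (i∉P i∈P)

    #≡0⇒∉ : # P? ≡ 0 → ∀ {i} → i ∉ P
    #≡0⇒∉ #P≡0 {i} i∈P = one≰zero (≤-trans (≤-∑ _ i) (≤-reflexive #P≡0))
      where
      one≰zero : ¬ ((if does (P? i) then 1 else 0) ≤ 0)
      one≰zero with P? i
      ... | yes _   = λ ()
      ... | no  i∉P = ⊥-elim (i∉P i∈P)

  module _ {P Q : Pred (Fin m) 0ℓ} (P? : Decidable P) (Q? : Decidable Q) where

    ∑⟨⟩-split : ∀ (f : Fin m → ℕ) → ∑⟨ P? ⟩ f ≡ ∑⟨ P? ∩? Q? ⟩ f + ∑⟨ P? ∖? Q? ⟩ f
    ∑⟨⟩-split f = trans (sum-cong-≗ pointwise) (∑-distrib-+ {m} _ _)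
      where
      pointwise : ∀ i → (if does (P? i) then f i else 0)
                      ≡ (if does (P? i) ∧ does (Q? i) then f i else 0)
                      + (if does (P? i) ∧ not (does (Q? i)) then f i else 0)
      pointwise i with does (P? i) | does (Q? i)
      ... | true  | true  = sym (+-identityʳ (f i))
      ... | true  | false = refl
      ... | false | _     = refl

    private
      if-⊆ : P ⊆ Q → ∀ k i → (if does (P? i) then k else 0) ≤ (if does (Q? i) then k else 0)
      if-⊆ P⊆Q k i with P? i | Q? i
      ... | yes _   | yes _   = ≤-refl
      ... | yes i∈P | no  i∉Q = ⊥-elim (i∉Q (P⊆Q i∈P))
      ... | no  _   | _       = z≤n

    ∑⟨⟩-mono-⊆ : ∀ (f : Fin m → ℕ) → P ⊆ Q → ∑⟨ P? ⟩ f ≤ ∑⟨ Q? ⟩ f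
    ∑⟨⟩-mono-⊆ f P⊆Q = ∑-mono-≤ (λ i → if-⊆ P⊆Q (f i) i)

    #-⊆-antisym : P ⊆ Q → # Q? ≤ # P? → Q ⊆ P
    #-⊆-antisym P⊆Q #Q≤#P {i} i∈Q = member (count≡ i)
      where
      count≡ : ∀ i → (if does (P? i) then 1 else 0) ≡ (if does (Q? i) then 1 else 0)
      count≡ = ∑-mono-≤-≡⇒≗ _ _ (if-⊆ P⊆Q 1) (≤-antisym (∑⟨⟩-mono-⊆ _ P⊆Q) #Q≤#P)
      member : (if does (P? i) then 1 else 0) ≡ (if does (Q? i) then 1 else 0) → i ∈ P
      member with P? i | Q? i
      ... | yes i∈P | _       = λ _ → i∈P
      ... | no  _   | yes _   = λ ()
      ... | no  _   | no  i∉Q = ⊥-elim (i∉Q i∈Q)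

  #-cong-≐ : {P Q : Pred (Fin m) 0ℓ} (P? : Decidable P) (Q? : Decidable Q) → P ≐ Q → # P? ≡ # Q?
  #-cong-≐ P? Q? (P⊆Q , Q⊆P) = ≤-antisym (∑⟨⟩-mono-⊆ P? Q? _ P⊆Q) (∑⟨⟩-mono-⊆ Q? P? _ Q⊆P)

pronic-even : ∀ k → ∃ λ q → suc k * k ≡ q * 2
pronic-even zero    = 0 , refl
pronic-even (suc k) = let q , k[k+1]≡2q = pronic-even k in
  q + suc k , trans (step k) (trans (cong (_+ suc k * 2) k[k+1]≡2q) (sym (*-distribʳ-+ 2 q (suc k))))
  where
  step : ∀ k → suc (suc k) * suc k ≡ suc k * k + suc k * 2
  step = solve-∀

-- 2p < n forces p ≤ n(n-1)/2, so the truncated subtraction in E is exact.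
edge-count-arith : ∀ {n p E S} → 0 < p → 2 * p < n →
                   E ≡ n * (n ∸ 1) / 2 ∸ p → 2 * E + S + n ≡ n * n → S ≡ 2 * p
edge-count-arith {suc k} {p} {E} {S} p>0 2p<n E≡ identity =
  +-cancelˡ-≡ (2 * E) S (2 * p) (+-cancelʳ-≡ (suc k) _ _ (begin
    2 * E + S + suc k            ≡⟨ identity ⟩
    suc k * suc k                ≡⟨ trans (*-suc (suc k) k) (+-comm (suc k) _) ⟩
    suc k * k + suc k            ≡⟨ cong (_+ suc k) (trans k[k+1]≡2q (*-comm q 2)) ⟩
    2 * q + suc k                ≡⟨ cong (λ e → 2 * e + suc k) (sym (m∸n+n≡m p≤q)) ⟩
    2 * (q ∸ p + p) + suc k      ≡⟨ cong (_+ suc k) (*-distribˡ-+ 2 (q ∸ p) p) ⟩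
    2 * (q ∸ p) + 2 * p + suc k  ≡⟨ cong (λ e → 2 * e + 2 * p + suc k) E≡q∸p ⟨
    2 * E + 2 * p + suc k        ∎))
  where
  open ≡-Reasoning
  q : ℕ
  q = proj₁ (pronic-even k)
  k[k+1]≡2q : suc k * k ≡ q * 2
  k[k+1]≡2q = proj₂ (pronic-even k)
  E≡q∸p : E ≡ q ∸ p
  E≡q∸p = trans E≡ (trans (cong (λ e → e / 2 ∸ p) k[k+1]≡2q) (cong (_∸ p) (m*n/n≡m q 2)))
  p≤k : p ≤ k
  p≤k = ≤-trans (m≤m+n p (p + 0)) (≤-pred 2p<n)
  p≤q : p ≤ q
  p≤q = ≤-trans p≤k (*-cancelʳ-≤ k q 2 (≤-trans (*-monoʳ-≤ k (s≤s (≤-trans p>0 p≤k)))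
                                                   (≤-reflexive (trans (*-comm k (suc k)) k[k+1]≡2q))))

-- The product t·a dominates t + a - 1 once both factors are positive.
twin-class-arith : ∀ {n a t t' r S} → 0 < a → 0 < t → S < n →
                   t * a + (r * 1 + a * t) ≤ S → suc n ≡ t + (t' + r) + a → t < t'
twin-class-arith {n} {suc a₀} {suc t₀} {t'} {r} {S} _ _ S<n lower partition =
  ≤-trans (s≤s (m≤n+m t a₀)) (+-cancelˡ-≤ (a + t + r) (a + t) t' (begin
    a + t + r + (a + t)               ≡⟨ regroup a t r ⟩
    2 * (a + t) + r                   ≤⟨ m≤m+n _ (2 * (a₀ * t₀)) ⟩
    2 * (a + t) + r + 2 * (a₀ * t₀)   ≡⟨ expand a₀ t₀ r ⟩
    t * a + (r * 1 + a * t) + 2       ≤⟨ +-monoˡ-≤ 2 lower ⟩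
    S + 2                             ≡⟨ +-comm S 2 ⟩
    suc (suc S)                       ≤⟨ s≤s S<n ⟩
    suc n                             ≡⟨ partition ⟩
    t + (t' + r) + a                  ≡⟨ reorder t t' r a ⟩
    a + t + r + t'                    ∎))
  where
  open ≤-Reasoning
  a t : ℕ
  a = suc a₀
  t = suc t₀
  regroup : ∀ a t r → a + t + r + (a + t) ≡ 2 * (a + t) + r
  regroup = solve-∀
  expand : ∀ a₀ t₀ r → 2 * (suc a₀ + suc t₀) + r + 2 * (a₀ * t₀) ≡ suc t₀ * suc a₀ + (r * 1 + suc a₀ * suc t₀) + 2
  expand = solve-∀
  reorder : ∀ t t' r a → t + (t' + r) + a ≡ a + t + r + t'
  reorder = solve-∀

-- Neighbourhoods and closed twins

module Neighbourhoods {m} (G : Graph m) where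

  N : Fin m → Pred (Fin m) 0ℓ
  N x z = T (adj G x z)

  N? : ∀ x → Decidable (N x)
  N? x z = T? (adj G x z)

  N[_] : Fin m → Pred (Fin m) 0ℓ
  N[ x ] = N x ∪ ｛ x ｝

  N[_]? : ∀ x → Decidable N[ x ]
  N[ x ]? = N? x ∪? (x Fin.≟_)

  shared unshared : Fin m → Fin m → ℕ
  shared   x y = # (N? x ∩? N? y)
  unshared x y = # (N? x ∖? N[ y ]?)

  -- Closed twins: N[x] = N[z] (twin⇒⊆, twin⇒⊇), phrased as a count so that it is decidable.
  twin : Fin m → Pred (Fin m) 0ℓ
  twin x z = z ∈ N[ x ] × unshared x z ≡ 0

  twin? : ∀ x → Decidable (twin x)
  twin? x z = N[ x ]? z ×-dec (unshared x z ≟ 0)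

  totalUnshared : Fin m → ℕ
  totalUnshared x = ∑⟨ N? x ⟩ (unshared x)

  N-sym : ∀ {x y} → y ∈ N x → x ∈ N y
  N-sym {x} {y} = subst T (Graph.sym G x y)

  N-irrefl : ∀ {x} → x ∉ N x
  N-irrefl {x} = subst T (loopless G x)

  N[]-self : ∀ {x} → x ∈ N[ x ]
  N[]-self = inj₂ refl

  N[]-sym : ∀ {x z} → z ∈ N[ x ] → x ∈ N[ z ]
  N[]-sym (inj₁ x~z) = inj₁ (N-sym x~z)
  N[]-sym (inj₂ refl) = N[]-self

  ⊆⇒unshared≡0 : ∀ {x y} → N[ x ] ⊆ N[ y ] → unshared x y ≡ 0
  ⊆⇒unshared≡0 {x} {y} N[x]⊆N[y] =
    #-empty (N? x ∖? N[ y ]?) λ z (x~z , z∉N[y]) → z∉N[y] (N[x]⊆N[y] (inj₁ x~z))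

  unshared≡0⇒⊆ : ∀ {x y} → y ∈ N[ x ] → unshared x y ≡ 0 → N[ x ] ⊆ N[ y ]
  unshared≡0⇒⊆ {x} {y} y∈N[x] u≡0 {z} z∈N[x] with N[ y ]? z
  ... | yes z∈N[y] = z∈N[y]
  ... | no  z∉N[y] with z∈N[x]
  ...   | inj₁ x~z  = ⊥-elim (#≡0⇒∉ (N? x ∖? N[ y ]?) u≡0 (x~z , z∉N[y]))
  ...   | inj₂ refl = N[]-sym y∈N[x]

  unshared-antitone : ∀ {x y z} → N[ y ] ⊆ N[ z ] → unshared x z ≤ unshared x y
  unshared-antitone {x} {y} {z} N[y]⊆N[z] =
    ∑⟨⟩-mono-⊆ (N? x ∖? N[ z ]?) (N? x ∖? N[ y ]?) _ λ (x~w , w∉N[z]) → x~w , w∉N[z] ∘ N[y]⊆N[z]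

  twin⇒⊆ : ∀ {x z} → z ∈ twin x → N[ x ] ⊆ N[ z ]
  twin⇒⊆ (z∈N[x] , u≡0) = unshared≡0⇒⊆ z∈N[x] u≡0

  ⊆⇒twin : ∀ {x z} → N[ x ] ⊆ N[ z ] → z ∈ twin x
  ⊆⇒twin N[x]⊆N[z] = N[]-sym (N[x]⊆N[z] N[]-self) , ⊆⇒unshared≡0 N[x]⊆N[z]

  non-twin⇒unshared>0 : ∀ {x z} → z ∈ N[ x ] → z ∉ twin x → 0 < unshared x z
  non-twin⇒unshared>0 z∈N[x] z∉twin = n≢0⇒n>0 (z∉twin ∘ (z∈N[x] ,_))

module Regular {m} (G : Graph m) {n} (regular : ∀ v → degree G v ≡ n) where

  open Neighbourhoods G public

  #N : ∀ x → # (N? x) ≡ n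
  #N x = trans (sym (sum-map-allFin (count ∘ adj G x))) (regular x)

  #N[] : ∀ x → # N[ x ]? ≡ suc n
  #N[] x = begin
    # N[ x ]?                                   ≡⟨ ∑⟨⟩-split N[ x ]? (N? x) _ ⟩
    # (N[ x ]? ∩? N? x) + # (N[ x ]? ∖? N? x)   ≡⟨ cong₂ _+_ (#-cong-≐ (N[ x ]? ∩? N? x) (N? x) (proj₂ , λ x~z → inj₁ x~z , x~z))
                                                              (#-singleton (N[ x ]? ∖? N? x) (N[]-self , N-irrefl) only-x) ⟩
    # (N? x) + 1                                ≡⟨ cong (_+ 1) (#N x) ⟩
    n + 1                                       ≡⟨ +-comm n 1 ⟩
    suc n                                       ∎
    where
    open ≡-Reasoning
    only-x : ∀ {z} → z ∈ N[ x ] ∖ N x → z ≡ x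
    only-x (inj₁ x~z  , x≁z) = ⊥-elim (x≁z x~z)
    only-x (inj₂ refl , _)   = refl

  twin⇒⊇ : ∀ {x z} → z ∈ twin x → N[ z ] ⊆ N[ x ]
  twin⇒⊇ {x} {z} x≈z =
    #-⊆-antisym N[ x ]? N[ z ]? (twin⇒⊆ x≈z) (≤-reflexive (trans (#N[] z) (sym (#N[] x))))

  twin-refl : ∀ {x} → x ∈ twin x
  twin-refl = ⊆⇒twin id

  twin-sym : ∀ {x z} → z ∈ twin x → x ∈ twin z
  twin-sym = ⊆⇒twin ∘ twin⇒⊇

  twin-trans : ∀ {x y z} → y ∈ twin x → z ∈ twin y → z ∈ twin x
  twin-trans x≈y y≈z = ⊆⇒twin (twin⇒⊆ y≈z ∘ twin⇒⊆ x≈y)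

  degree-split : ∀ {x y} → y ∈ N x → n ≡ shared x y + unshared x y + 1
  degree-split {x} {y} x~y = begin
    n                               ≡⟨ #N x ⟨
    # (N? x)                        ≡⟨ ∑⟨⟩-split (N? x) (N? y) _ ⟩
    shared x y + # (N? x ∖? N? y)   ≡⟨ cong (shared x y +_) #N∖N ⟩
    shared x y + (unshared x y + 1) ≡⟨ +-assoc (shared x y) _ 1 ⟨
    shared x y + unshared x y + 1   ∎
    where
    open ≡-Reasoning
    only-y : ∀ {z} → z ∈ (N x ∖ N y) ∩ N[ y ] → z ≡ y
    only-y ((_ , y≁z) , inj₁ y~z)  = ⊥-elim (y≁z y~z)
    only-y ((_ , _)   , inj₂ refl) = refl
    N∖N∖N[]≐N∖N[] : (N x ∖ N y) ∖ N[ y ] ≐ N x ∖ N[ y ]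
    N∖N∖N[]≐N∖N[] = (λ ((x~z , _) , z∉N[y]) → x~z , z∉N[y])
                  , (λ (x~z , z∉N[y]) → (x~z , z∉N[y] ∘ inj₁) , z∉N[y])
    #N∖N : # (N? x ∖? N? y) ≡ unshared x y + 1
    #N∖N = begin
      # (N? x ∖? N? y)                                        ≡⟨ ∑⟨⟩-split (N? x ∖? N? y) N[ y ]? _ ⟩
      # ((N? x ∖? N? y) ∩? N[ y ]?) + # ((N? x ∖? N? y) ∖? N[ y ]?)
        ≡⟨ cong₂ _+_ (#-singleton ((N? x ∖? N? y) ∩? N[ y ]?) ((x~y , N-irrefl) , N[]-self) only-y)
                     (#-cong-≐ ((N? x ∖? N? y) ∖? N[ y ]?) (N? x ∖? N[ y ]?) N∖N∖N[]≐N∖N[]) ⟩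
      1 + unshared x y                                        ≡⟨ +-comm 1 _ ⟩
      unshared x y + 1                                        ∎

  ∑shared≡2*nbhdEdges : ∀ y → ∑⟨ N? y ⟩ (shared y) ≡ 2 * nbhdEdges G y
  ∑shared≡2*nbhdEdges y = begin
    ∑⟨ N? y ⟩ (shared y)                         ≡⟨ sum-cong-≗ restrict ⟩
    ∑ (λ i → ∑ (λ j → count (E i j)))             ≡⟨ ∑∑-count-symmetric E E-sym E-irrefl ⟩
    2 * ∑ (λ i → ∑ (λ j → count ((toℕ i <ᵇ toℕ j) ∧ E i j)))
      ≡⟨ cong (2 *_) nbhdEdges≡∑∑ ⟨
    2 * nbhdEdges G y                            ∎
    where
    open ≡-Reasoning
    E : Fin m → Fin m → Bool
    E i j = adj G y i ∧ (adj G y j ∧ adj G i j)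
    nbhdEdges≡∑∑ : nbhdEdges G y ≡ ∑ (λ i → ∑ (λ j → count ((toℕ i <ᵇ toℕ j) ∧ E i j)))
    nbhdEdges≡∑∑ = trans (sum-map-allFin {m} _)
                         (sum-cong-≗ (λ i → sum-map-allFin (λ j → count ((toℕ i <ᵇ toℕ j) ∧ E i j))))
    E-sym : ∀ i j → E i j ≡ E j i
    E-sym i j = begin
      adj G y i ∧ (adj G y j ∧ adj G i j)   ≡⟨ ∧-assoc (adj G y i) _ _ ⟨
      (adj G y i ∧ adj G y j) ∧ adj G i j   ≡⟨ cong₂ _∧_ (∧-comm (adj G y i) _) (Graph.sym G i j) ⟩
      (adj G y j ∧ adj G y i) ∧ adj G j i   ≡⟨ ∧-assoc (adj G y j) _ _ ⟩
      adj G y j ∧ (adj G y i ∧ adj G j i)   ∎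
    E-irrefl : ∀ i → E i i ≡ false
    E-irrefl i = begin
      adj G y i ∧ (adj G y i ∧ adj G i i)   ≡⟨ cong (λ b → adj G y i ∧ (adj G y i ∧ b)) (loopless G i) ⟩
      adj G y i ∧ (adj G y i ∧ false)       ≡⟨ cong (adj G y i ∧_) (∧-zeroʳ _) ⟩
      adj G y i ∧ false                     ≡⟨ ∧-zeroʳ _ ⟩
      false                                 ∎
    restrict : ∀ i → (if adj G y i then shared y i else 0) ≡ ∑ (λ j → count (E i j))
    restrict i with adj G y i
    ... | true  = refl
    ... | false = sym (sum-replicate-zero m)

  counting-identity : ∀ y → 2 * nbhdEdges G y + totalUnshared y + n ≡ n * n
  counting-identity y = begin
    2 * nbhdEdges G y + totalUnshared y + n
      ≡⟨ cong₂ (λ e d → e + totalUnshared y + d) (∑shared≡2*nbhdEdges y) (#N y) ⟨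
    ∑⟨ N? y ⟩ (shared y) + ∑⟨ N? y ⟩ (unshared y) + # (N? y)
      ≡⟨ cong (_+ # (N? y)) (∑⟨⟩-distrib-+ (N? y) (shared y) (unshared y)) ⟨
    ∑⟨ N? y ⟩ (λ z → shared y z + unshared y z) + # (N? y)
      ≡⟨ ∑⟨⟩-distrib-+ (N? y) (λ z → shared y z + unshared y z) (λ _ → 1) ⟨
    ∑⟨ N? y ⟩ (λ z → shared y z + unshared y z + 1)
      ≡⟨ ∑⟨⟩-cong (N? y) (λ y~z → sym (degree-split y~z)) ⟩
    ∑⟨ N? y ⟩ (λ _ → n)                           ≡⟨ ∑⟨⟩-const (N? y) n ⟩
    # (N? y) * n                                  ≡⟨ cong (_* n) (#N y) ⟩
    n * n                                         ∎
    where open ≡-Reasoning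

  totalUnshared-bounds : ∀ {y p} → 0 < p → 2 * p < n → nbhdEdges G y ≡ n * (n ∸ 1) / 2 ∸ p →
                         0 < totalUnshared y × totalUnshared y < n
  totalUnshared-bounds {y} {p} p>0 2p<n edges
    rewrite edge-count-arith p>0 2p<n edges (counting-identity y) = ≤-trans p>0 (m≤m+n p (p + 0)) , 2p<n

  module AdjacentNonTwins {x v} (x~v : v ∈ N x) (x≉v : v ∉ twin x) where

    x∈N[v] : x ∈ N[ v ]
    x∈N[v] = N[]-sym (inj₁ x~v)

    twin-v⊆N-x : twin v ⊆ N x
    twin-v⊆N-x {z} v≈z with N[]-sym (twin⇒⊆ v≈z x∈N[v])
    ... | inj₁ x~z  = x~z
    ... | inj₂ refl = ⊥-elim (x≉v (twin-sym v≈z))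

    twin-x⊆N[v] : twin x ⊆ N[ v ]
    twin-x⊆N[v] x≈z = N[]-sym (twin⇒⊆ x≈z (inj₁ x~v))

    twins-disjoint : ∀ {z} → z ∈ twin v → z ∉ twin x
    twins-disjoint v≈z x≈z = x≉v (twin-trans x≈z (twin-sym v≈z))

    R? : Decidable (((N[ x ] ∩ N[ v ]) ∖ twin v) ∖ twin x)
    R? = ((N[ x ]? ∩? N[ v ]?) ∖? twin? v) ∖? twin? x

    closed-nbhd-partition : # N[ x ]? ≡ # (twin? v) + (# (twin? x) + # R?) + unshared x v
    closed-nbhd-partition = begin
      # N[ x ]?
        ≡⟨ ∑⟨⟩-split N[ x ]? N[ v ]? _ ⟩
      # (N[ x ]? ∩? N[ v ]?) + # (N[ x ]? ∖? N[ v ]?)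
        ≡⟨ cong₂ _+_ (∑⟨⟩-split (N[ x ]? ∩? N[ v ]?) (twin? v) _) (#-cong-≐ (N[ x ]? ∖? N[ v ]?) (N? x ∖? N[ v ]?) outside-v) ⟩
      # ((N[ x ]? ∩? N[ v ]?) ∩? twin? v) + # ((N[ x ]? ∩? N[ v ]?) ∖? twin? v) + unshared x v
        ≡⟨ cong (λ k → k + unshared x v) (cong₂ _+_ (#-cong-≐ ((N[ x ]? ∩? N[ v ]?) ∩? twin? v) (twin? v) in-twin-v)
                                                      (∑⟨⟩-split ((N[ x ]? ∩? N[ v ]?) ∖? twin? v) (twin? x) _)) ⟩
      # (twin? v) + (# (((N[ x ]? ∩? N[ v ]?) ∖? twin? v) ∩? twin? x) + # R?) + unshared x v
        ≡⟨ cong (λ k → # (twin? v) + (k + # R?) + unshared x v)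
                (#-cong-≐ (((N[ x ]? ∩? N[ v ]?) ∖? twin? v) ∩? twin? x) (twin? x) in-twin-x) ⟩
      # (twin? v) + (# (twin? x) + # R?) + unshared x v ∎
      where
      open ≡-Reasoning
      outside-v : N[ x ] ∖ N[ v ] ≐ N x ∖ N[ v ]
      outside-v = (λ where (inj₁ x~z , z∉N[v]) → x~z , z∉N[v]
                           (inj₂ refl , x∉N[v]) → ⊥-elim (x∉N[v] x∈N[v]))
                , (λ (x~z , z∉N[v]) → inj₁ x~z , z∉N[v])
      in-twin-v : (N[ x ] ∩ N[ v ]) ∩ twin v ≐ twin v
      in-twin-v = proj₂ , λ v≈z → (inj₁ (twin-v⊆N-x v≈z) , proj₁ v≈z) , v≈z
      in-twin-x : ((N[ x ] ∩ N[ v ]) ∖ twin v) ∩ twin x ≐ twin x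
      in-twin-x = proj₂ , λ x≈z → ((proj₁ x≈z , twin-x⊆N[v] x≈z) , λ v≈z → twins-disjoint v≈z x≈z) , x≈z

    totalUnshared-lower-bound :
      # (twin? v) * unshared x v + (# R? * 1 + unshared x v * # (twin? v)) ≤ totalUnshared x
    totalUnshared-lower-bound = begin
      # (twin? v) * unshared x v + (# R? * 1 + unshared x v * # (twin? v))
        ≤⟨ +-mono-≤ on-twin-v (+-mono-≤ on-R on-N[v]ᶜ) ⟩
      ∑⟨ N? x ∩? twin? v ⟩ f + (∑⟨ (N? x ∖? twin? v) ∩? N[ v ]? ⟩ f + ∑⟨ (N? x ∖? twin? v) ∖? N[ v ]? ⟩ f)
        ≡⟨ cong (∑⟨ N? x ∩? twin? v ⟩ f +_) (∑⟨⟩-split (N? x ∖? twin? v) N[ v ]? f) ⟨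
      ∑⟨ N? x ∩? twin? v ⟩ f + ∑⟨ N? x ∖? twin? v ⟩ f
        ≡⟨ ∑⟨⟩-split (N? x) (twin? v) f ⟨
      totalUnshared x ∎
      where
      open ≤-Reasoning
      f : Fin m → ℕ
      f = unshared x
      on-twin-v : # (twin? v) * unshared x v ≤ ∑⟨ N? x ∩? twin? v ⟩ f
      on-twin-v = ≤-trans
        (≤-reflexive (cong (_* unshared x v) (#-cong-≐ (twin? v) (N? x ∩? twin? v) ((λ v≈z → twin-v⊆N-x v≈z , v≈z) , proj₂))))
        (#*≤∑⟨⟩ (N? x ∩? twin? v) f _ λ (_ , v≈z) → unshared-antitone (twin⇒⊇ v≈z))
      on-R : # R? * 1 ≤ ∑⟨ (N? x ∖? twin? v) ∩? N[ v ]? ⟩ f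
      on-R = ≤-trans (#*≤∑⟨⟩ R? f 1 λ (((z∈N[x] , _) , _) , x≉z) → non-twin⇒unshared>0 z∈N[x] x≉z)
                     (∑⟨⟩-mono-⊆ R? ((N? x ∖? twin? v) ∩? N[ v ]?) f R⊆)
        where
        R⊆ : ((N[ x ] ∩ N[ v ]) ∖ twin v) ∖ twin x ⊆ (N x ∖ twin v) ∩ N[ v ]
        R⊆ (((inj₁ x~z , z∈N[v]) , v≉z) , _)  = (x~z , v≉z) , z∈N[v]
        R⊆ (((inj₂ refl , _) , _) , x≉x)       = ⊥-elim (x≉x twin-refl)
      on-N[v]ᶜ : unshared x v * # (twin? v) ≤ ∑⟨ (N? x ∖? twin? v) ∖? N[ v ]? ⟩ f
      on-N[v]ᶜ = ≤-trans
        (≤-reflexive (cong (_* # (twin? v)) (#-cong-≐ (N? x ∖? N[ v ]?) ((N? x ∖? twin? v) ∖? N[ v ]?)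
          ((λ (x~z , z∉N[v]) → (x~z , z∉N[v] ∘ proj₁) , z∉N[v]) , λ ((x~z , _) , z∉N[v]) → x~z , z∉N[v]))))
        (#*≤∑⟨⟩ ((N? x ∖? twin? v) ∖? N[ v ]?) f _ λ ((_ , _) , z∉N[v]) → twin-v⊆unshared z∉N[v])
        where
        -- every twin w of v is a neighbour of x that misses z, since z ∉ N[v] = N[w]
        twin-v⊆unshared : ∀ {z} → z ∉ N[ v ] → # (twin? v) ≤ unshared x z
        twin-v⊆unshared {z} z∉N[v] = ∑⟨⟩-mono-⊆ (twin? v) (N? x ∖? N[ z ]?) _
          λ v≈w → twin-v⊆N-x v≈w , λ w∈N[z] → z∉N[v] (twin⇒⊇ v≈w (N[]-sym w∈N[z]))

    twin-class-grows : totalUnshared x < n → # (twin? v) < # (twin? x)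
    twin-class-grows S<n = twin-class-arith
      (non-twin⇒unshared>0 (inj₁ x~v) x≉v)
      (n≢0⇒n>0 λ #≡0 → #≡0⇒∉ (twin? v) #≡0 twin-refl)
      S<n totalUnshared-lower-bound (trans (sym (#N[] x)) closed-nbhd-partition)

mainTheorem5 : (n m : ℕ) → 0 < m → (G : Graph m) →
    (∀ v → degree G v ≡ n) →
    ¬ (∀ (v : Fin m) → ∃ λ (p : ℕ) →
    1 ≤ p × 2 * p < n × nbhdEdges G v ≡ n * (n ∸ 1) / 2 ∸ p)
mainTheorem5 n (suc m) _ G regular edges =
  <-asym (xv.twin-class-grows (proj₂ (bounds x))) (vx.twin-class-grows (proj₂ (bounds v)))
  where
  open Regular G regular
  bounds : ∀ y → 0 < totalUnshared y × totalUnshared y < n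
  bounds y = let _ , p>0 , 2p<n , edges-y = edges y in totalUnshared-bounds p>0 2p<n edges-y
  v : Fin (suc m)
  v = zero
  x-witness : ∃ λ x → x ∈ N v × 0 < unshared v x
  x-witness = ∑⟨⟩-pos⇒∃ (N? v) (unshared v) (proj₁ (bounds v))
  x : Fin (suc m)
  x = proj₁ x-witness
  v~x : x ∈ N v
  v~x = proj₁ (proj₂ x-witness)
  v≉x : x ∉ twin v
  v≉x (_ , unshared≡0) = <⇒≢ (proj₂ (proj₂ x-witness)) (sym unshared≡0)
  module xv = AdjacentNonTwins (N-sym v~x) (v≉x ∘ twin-sym)
  module vx = AdjacentNonTwins v~x v≉x
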